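{- Let $U$ and $V$ be theories in the same signature $\mathcal{L}$ such that $U$ is $\tau$-$\mathsf{R}_{0\mathsf{p}}$-sourced and $V$ is $\tau'$-$\mathsf{R}_{0\mathsf{p}}$-sourced, where the restrictions of the translations $\tau$ and $\tau'$ to the arithmetical signature $\mathbb{L}_{\sf a}$ coincide. Then $U\cup V$ is $\mathsf{R}_{0\mathsf{p}}$-sourced.
   Context: $\mathbb{L}_{\sf a}=\{0,\mathsf{S},+,\times,\leq\}$ with $\leq$ primitive; $\mathbb{L}_{\sf ap}$ is $\mathbb{L}_{\sf a}$ plus a unary predicate $\mathsf{P}$; $\mathfrak{id}_{\sf ap}$ are the identity axioms of $\mathbb{L}_{\sf ap}$. $\mathsf{R}_0$ is the $\mathbb{L}_{\sf a}$-theory with axioms, for all $m,n\in\omega$: $\overline{m}+\overline{n}=\overline{m+n}$; $\overline{m}\times\overline{n}=\overline{m\times n}$; $\overline{m}\neq\overline{n}$ if $m\neq n$; $\forall x\,(x\leq\overline{n}\to\bigvee_{i\leq n}x=\overline{i})$; $\overline{m}\leq\overline{n}$ if $m\leq n$ ($\overline{n}$ numerals). $\mathsf{R}_{0\mathsf{p}}$ is $\mathsf{R}_0$ plus $\mathsf{P}(\overline{n})$ for all $n$. A translation from signature $\Theta$ to $\Xi$ gives a domain formula and, for each relation symbol (identity included; function symbols via graphs), a $\Xi$-formula, extended to all formulas by commuting with connectives and relativizing quantifiers. A c.e. theory $W$ is $\tau$-$\mathsf{R}_{0\mathsf{p}}$-sourced iff $W$ is deductively equivalent to $(\mathsf{R}_{0\mathsf{p}}+\mathfrak{id}_{\sf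 ap})^\tau$; it is $\mathsf{R}_{0\mathsf{p}}$-sourced iff it is $\tau$-$\mathsf{R}_{0\mathsf{p}}$-sourced for some $\tau$. $U\cup V$ is the theory axiomatized by the union of the axioms of $U$ and $V$. -}

module Defs where

open import Data.Nat using (ℕ; zero; suc; _+_; _*_; _≤_)
open import Data.Fin using (Fin; zero; suc)
open import Data.Vec using (Vec; []; _∷_; tabulate; _∷ʳ_; lookup; _[_]≔_)
open import Data.Empty using (⊥)
open import Data.Product using (Σ; _×_; _,_; ∃)
open import Data.Sum using (_⊎_)
open import Data.Maybe using (Maybe; just)
open import Relation.Binary.PropositionalEquality using (_≡_; _≢_)

-- First-order signatures (identity is logical, not a relation symbol)

record Signature : Set₁ where
  field
    Fun      : Set
    funArity : Fun → ℕ
    Rel      : Set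
    relArity : Rel → ℕ
open Signature public

-- Well-scoped syntax (de Bruijn indices; n = number of free variables)

data Term (L : Signature) (n : ℕ) : Set where
  var : Fin n → Term L n
  fun : (f : Fun L) → Vec (Term L n) (funArity L f) → Term L n

infixr 4 _⇒_
infix 8 _≐_

data Formula (L : Signature) (n : ℕ) : Set where
  rel : (R : Rel L) → Vec (Term L n) (relArity L R) → Formula L n
  _≐_ : Term L n → Term L n → Formula L n
  ⊥'  : Formula L n
  _⇒_ : Formula L n → Formula L n → Formula L n
  ∀'  : Formula L (suc n) → Formula L n

Sentence : Signature → Set
Sentence L = Formula L 0

-- a theory is given by (a predicate describing) its set of axioms
Theory : Signature → Set₁
Theory L = Sentence L → Set

infix 7 ¬'_
infixr 5 _∨'_
infixr 6 _∧'_

¬'_ : ∀ {L n} → Formula L n → Formula L n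
¬' φ = φ ⇒ ⊥'

_∨'_ : ∀ {L n} → Formula L n → Formula L n → Formula L n
φ ∨' ψ = (¬' φ) ⇒ ψ

_∧'_ : ∀ {L n} → Formula L n → Formula L n → Formula L n
φ ∧' ψ = ¬' (φ ⇒ ¬' ψ)

∃' : ∀ {L n} → Formula L (suc n) → Formula L n
∃' φ = ¬' (∀' (¬' φ))

Ren : ℕ → ℕ → Set
Ren m n = Fin m → Fin n

liftRen : ∀ {m n} → Ren m n → Ren (suc m) (suc n)
liftRen ρ zero    = zero
liftRen ρ (suc i) = suc (ρ i)

mutual
  renTerm : ∀ {L m n} → Ren m n → Term L m → Term L n
  renTerm ρ (var i)    = var (ρ i)
  renTerm ρ (fun f ts) = fun f (renTerms ρ ts)

  renTerms : ∀ {L m n k} → Ren m n → Vec (Term L m) k → Vec (Term L n) k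
  renTerms ρ []       = []
  renTerms ρ (t ∷ ts) = renTerm ρ t ∷ renTerms ρ ts

ren : ∀ {L m n} → Ren m n → Formula L m → Formula L n
ren ρ (rel R ts) = rel R (renTerms ρ ts)
ren ρ (s ≐ t)    = renTerm ρ s ≐ renTerm ρ t
ren ρ ⊥'         = ⊥'
ren ρ (φ ⇒ ψ)    = ren ρ φ ⇒ ren ρ ψ
ren ρ (∀' φ)     = ∀' (ren (liftRen ρ) φ)

Sub : Signature → ℕ → ℕ → Set
Sub L m n = Fin m → Term L n

liftSub : ∀ {L m n} → Sub L m n → Sub L (suc m) (suc n)
liftSub σ zero    = var zero
liftSub σ (suc i) = renTerm suc (σ i)

mutual
  subTerm : ∀ {L m n} → Sub L m n → Term L m → Term L n
  subTerm σ (var i)    = σ i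
  subTerm σ (fun f ts) = fun f (subTerms σ ts)

  subTerms : ∀ {L m n k} → Sub L m n → Vec (Term L m) k → Vec (Term L n) k
  subTerms σ []       = []
  subTerms σ (t ∷ ts) = subTerm σ t ∷ subTerms σ ts

sub : ∀ {L m n} → Sub L m n → Formula L m → Formula L n
sub σ (rel R ts) = rel R (subTerms σ ts)
sub σ (s ≐ t)    = subTerm σ s ≐ subTerm σ t
sub σ ⊥'         = ⊥'
sub σ (φ ⇒ ψ)    = sub σ φ ⇒ sub σ ψ
sub σ (∀' φ)     = ∀' (sub (liftSub σ) φ)

wk : ∀ {L n} → Formula L n → Formula L (suc n)
wk = ren suc

_[_]₀ : ∀ {L n} → Formula L (suc n) → Term L n → Formula L n
φ [ t ]₀ = sub (λ { zero → t ; (suc i) → var i }) φ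

open₀ : ∀ {L n} → Sentence L → Formula L n
open₀ = ren (λ ())

allClose : ∀ {L} (k : ℕ) → Formula L k → Sentence L
allClose zero    φ = φ
allClose (suc k) φ = allClose k (∀' φ)

infix 2 _⊢_
data _⊢_ {L : Signature} (T : Theory L) : ∀ {n} → Formula L n → Set where
  axiom : ∀ {n} {φ : Sentence L} → T φ → T ⊢ open₀ {L} {n} φ
  ax-K  : ∀ {n} {φ ψ : Formula L n} → T ⊢ φ ⇒ ψ ⇒ φ
  ax-S  : ∀ {n} {φ ψ χ : Formula L n} →
          T ⊢ (φ ⇒ ψ ⇒ χ) ⇒ (φ ⇒ ψ) ⇒ φ ⇒ χ
  ax-DN : ∀ {n} {φ : Formula L n} → T ⊢ (¬' (¬' φ)) ⇒ φ
  mp    : ∀ {n} {φ ψ : Formula L n} → T ⊢ φ ⇒ ψ → T ⊢ φ → T ⊢ ψ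
  gen   : ∀ {n} {φ : Formula L (suc n)} → T ⊢ φ → T ⊢ ∀' φ
  ax-∀E : ∀ {n} {φ : Formula L (suc n)} (t : Term L n) →
          T ⊢ ∀' φ ⇒ φ [ t ]₀
  ax-∀D : ∀ {n} {φ : Formula L n} {ψ : Formula L (suc n)} →
          T ⊢ ∀' (wk φ ⇒ ψ) ⇒ φ ⇒ ∀' ψ
  ax-refl : ∀ {n} (t : Term L n) → T ⊢ t ≐ t
  ax-leib : ∀ {n} {φ : Formula L (suc n)} (s t : Term L n) →
            T ⊢ s ≐ t ⇒ φ [ s ]₀ ⇒ φ [ t ]₀

_∪ᵀ_ : ∀ {L} → Theory L → Theory L → Theory L
(U ∪ᵀ V) φ = U φ ⊎ V φ

_≡ᵈ_ : ∀ {L} → Theory L → Theory L → Set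
U ≡ᵈ W = (∀ (φ : Sentence _) → U ⊢ φ → W ⊢ φ) × (∀ (φ : Sentence _) → W ⊢ φ → U ⊢ φ)

-- computably enumerable: the axiom set is the range of an enumeration
-- (in constructive type theory every such function is computable)
IsCE : ∀ {L} → Theory L → Set
IsCE {L} W = Σ (ℕ → Maybe (Sentence L)) λ e →
  ∀ (φ : Sentence L) → (W φ → ∃ λ k → e k ≡ just φ) × ((∃ λ k → e k ≡ just φ) → W φ)

-- The signature 𝕃_ap in relational form (function symbols via graphs)

data FunAp : Set where
  zeroF succF addF mulF : FunAp

funArityAp : FunAp → ℕ
funArityAp zeroF = 0
funArityAp succF = 1
funArityAp addF  = 2
funArityAp mulF  = 2

data RelAp : Set where
  graph : FunAp → RelAp     -- graph f (x₁..x_k , y)  :  f(x₁..x_k) = y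
  leq   : RelAp
  prd   : RelAp

relArityAp : RelAp → ℕ
relArityAp (graph f) = suc (funArityAp f)
relArityAp leq       = 2
relArityAp prd       = 1

Lap : Signature
Lap = record { Fun = ⊥ ; funArity = λ () ; Rel = RelAp ; relArity = relArityAp }

-- Translations from 𝕃_ap into L (one-dimensional, no parameters)

record Translation (L : Signature) : Set where
  field
    dom  : Formula L 1
    eqF  : Formula L 2
    relF : (R : RelAp) → Formula L (relArityAp R)
open Translation public

module _ {L : Signature} (τ : Translation L) where
  trTerm : ∀ {n} → Term Lap n → Term L n
  trTerm (var i) = var i
  trTerm (fun () _)

  trTerms : ∀ {n k} → Vec (Term Lap n) k → Vec (Term L n) k
  trTerms []       = []
  trTerms (t ∷ ts) = trTerm t ∷ trTerms ts

  translate : ∀ {n} → Formula Lap n → Formula L n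
  translate (rel R ts) = sub (lookup (trTerms ts)) (relF τ R)
  translate (s ≐ t)    = sub (lookup (trTerm s ∷ trTerm t ∷ [])) (eqF τ)
  translate ⊥'         = ⊥'
  translate (φ ⇒ ψ)    = translate φ ⇒ translate ψ
  translate (∀' φ)     = ∀' (ren (λ _ → zero) (dom τ) ⇒ translate φ)

-- the restrictions of τ and τ' to 𝕃_a (domain, identity, 0,S,+,×,≤) coincide
AgreeOn𝕃a : ∀ {L} → Translation L → Translation L → Set
AgreeOn𝕃a τ τ' =
  (dom τ ≡ dom τ') × (eqF τ ≡ eqF τ') ×
  ((∀ f → relF τ (graph f) ≡ relF τ' (graph f)) × (relF τ leq ≡ relF τ' leq))

-- The theory R₀ₚ + 𝔦𝔡_ap (axioms unnested into the relational signature)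

private
  v : ∀ {n} → Fin n → Term Lap n
  v = var

  f0 : ∀ {n} → Fin (suc n)
  f0 = zero
  f1 : ∀ {n} → Fin (suc (suc n))
  f1 = suc zero
  f2 : ∀ {n} → Fin (suc (suc (suc n)))
  f2 = suc (suc zero)

-- Num k (x) : "x is the value of the numeral k̄"
Num : ℕ → Formula Lap 1
Num zero    = rel (graph zeroF) (var zero ∷ [])
Num (suc k) = ∃' (ren (λ _ → zero) (Num k) ∧' rel (graph succF) (var zero ∷ var (suc zero) ∷ []))

isNum : ∀ {n} → ℕ → Fin n → Formula Lap n
isNum k i = ren (λ _ → i) (Num k)

numUpTo : ℕ → Formula Lap 1
numUpTo zero    = Num zero
numUpTo (suc n) = numUpTo n ∨' Num (suc n)

plusAx : ℕ → ℕ → Sentence Lap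
plusAx m n = ∃' (∃' (∃' (isNum m f2 ∧' isNum n f1 ∧' isNum (m + n) f0 ∧'
               rel (graph addF) (v f2 ∷ v f1 ∷ v f0 ∷ []))))

timesAx : ℕ → ℕ → Sentence Lap
timesAx m n = ∃' (∃' (∃' (isNum m f2 ∧' isNum n f1 ∧' isNum (m * n) f0 ∧'
                rel (graph mulF) (v f2 ∷ v f1 ∷ v f0 ∷ []))))

neqAx : ℕ → ℕ → Sentence Lap
neqAx m n = ¬' ∃' (∃' (isNum m f1 ∧' isNum n f0 ∧' v f1 ≐ v f0))

leBoundAx : ℕ → Sentence Lap
leBoundAx n = ∀' (∃' (isNum n f0 ∧' rel leq (v f1 ∷ v f0 ∷ [])) ⇒ numUpTo n)

leAx : ℕ → ℕ → Sentence Lap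
leAx m n = ∃' (∃' (isNum m f1 ∧' isNum n f0 ∧' rel leq (v f1 ∷ v f0 ∷ [])))

pAx : ℕ → Sentence Lap
pAx n = ∃' (isNum n f0 ∧' rel prd (v f0 ∷ []))

eqReflAx : Sentence Lap
eqReflAx = ∀' (v f0 ≐ v f0)

-- congruence of R in argument position j
relCongAx : (R : RelAp) → Fin (relArityAp R) → Sentence Lap
relCongAx R j = allClose (suc (relArityAp R))
  ((xs j ≐ v f0) ∧' rel R (tabulate (λ i → v (suc i))) ⇒
    rel R (tabulate (λ i → v (suc i)) [ j ]≔ v f0))
  where xs : Fin (relArityAp R) → Term Lap (suc (relArityAp R))
        xs i = v (suc i)

-- congruence of = in argument position j
eqCongAx : Fin 2 → Sentence Lap
eqCongAx j = allClose 3
  ((lookup xs j ≐ v f0) ∧' (lookup xs f0 ≐ lookup xs f1) ⇒ (lookup ys f0 ≐ lookup ys f1))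
  where xs : Vec (Term Lap 3) 2
        xs = v f1 ∷ v f2 ∷ []
        ys : Vec (Term Lap 3) 2
        ys = xs [ j ]≔ v f0

totalAx : FunAp → Sentence Lap
totalAx f = allClose (funArityAp f)
  (∃' (rel (graph f) (tabulate (λ i → v (suc i)) ∷ʳ v f0)))

functionalAx : FunAp → Sentence Lap
functionalAx f = allClose (suc (suc (funArityAp f)))
  (rel (graph f) (xs ∷ʳ v f1) ∧' rel (graph f) (xs ∷ʳ v f0) ⇒ v f1 ≐ v f0)
  where xs : Vec (Term Lap (suc (suc (funArityAp f)))) (funArityAp f)
        xs = tabulate (λ i → v (suc (suc i)))

data R0p+id : Sentence Lap → Set where
  plus       : ∀ m n → R0p+id (plusAx m n)
  times      : ∀ m n → R0p+id (timesAx m n)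
  neq        : ∀ m n → m ≢ n → R0p+id (neqAx m n)
  leBound    : ∀ n → R0p+id (leBoundAx n)
  le         : ∀ m n → m ≤ n → R0p+id (leAx m n)
  pred       : ∀ n → R0p+id (pAx n)
  idRefl     : R0p+id eqReflAx
  idRel      : ∀ R j → R0p+id (relCongAx R j)
  idEq       : ∀ j → R0p+id (eqCongAx j)
  idTotal    : ∀ f → R0p+id (totalAx f)
  idFunction : ∀ f → R0p+id (functionalAx f)

translatedR0p : ∀ {L} → Translation L → Theory L
translatedR0p {L} τ ψ = Σ (Sentence Lap) λ φ → R0p+id φ × (ψ ≡ translate τ φ)

SourcedBy : ∀ {L} → Translation L → Theory L → Set
SourcedBy τ W = IsCE W × (W ≡ᵈ translatedR0p τ)

Sourced : ∀ {L} → Theory L → Set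
Sourced {L} W = Σ (Translation L) λ τ → SourcedBy τ W

-- Let P and P' be the τ- and τ'-translations of the predicate P, and C the conjunction
-- of their translated congruence axioms. The translation τ'' that agrees with τ on 𝕃a
-- and sends P to C ∧ P ∧ P' sources U ∪ V. Axioms not mentioning P translate alike
-- under τ, τ' and τ''. The τ''-translation of P(n̄) yields those under τ and τ', and
-- that of P(0̄) yields C. Conversely, U gives some x = n̄ with P x and V some y = n̄ with
-- P' y; translated numerals are provably unique (by induction on n, from functionality
-- and congruence of the successor graph), so x = y and P' x by congruence of P'.
-- Unions of c.e. theories are c.e. by interleaving enumerations.

module Submission where

open import Defs
open import Data.Nat using (ℕ; zero; suc; _+_; _*_)
open import Data.Fin using (Fin; zero; suc; #_)
open import Data.Vec using (Vec; []; _∷_; lookup)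
import Data.Vec as Vec
open import Data.List using (List; []; _∷_; map)
open import Data.List.Membership.Propositional using (_∈_)
open import Data.List.Relation.Unary.Any using (here; there)
open import Data.Product using (_,_; proj₁; proj₂; ∃; swap)
open import Data.Sum using (_⊎_; inj₁; inj₂)
open import Data.Maybe using (just)
open import Function using (_∘_; id)
open import Relation.Binary.PropositionalEquality

module Substitution {L : Signature} where

  mutual
    subTerm-cong : ∀ {m n} {σ σ' : Sub L m n} → σ ≗ σ' → subTerm σ ≗ subTerm σ'
    subTerm-cong e (var i)    = e i
    subTerm-cong e (fun f ts) = cong (fun f) (subTerms-cong e ts)

    subTerms-cong : ∀ {m n k} {σ σ' : Sub L m n} → σ ≗ σ' → subTerms {k = k} σ ≗ subTerms σ'
    subTerms-cong e []       = refl
    subTerms-cong e (t ∷ ts) = cong₂ _∷_ (subTerm-cong e t) (subTerms-cong e ts)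

  mutual
    renTerm≗subTerm : ∀ {m n} (ρ : Ren m n) → renTerm {L} ρ ≗ subTerm (var ∘ ρ)
    renTerm≗subTerm ρ (var i)    = refl
    renTerm≗subTerm ρ (fun f ts) = cong (fun f) (renTerms≗subTerms ρ ts)

    renTerms≗subTerms : ∀ {m n k} (ρ : Ren m n) → renTerms {L} {k = k} ρ ≗ subTerms (var ∘ ρ)
    renTerms≗subTerms ρ []       = refl
    renTerms≗subTerms ρ (t ∷ ts) = cong₂ _∷_ (renTerm≗subTerm ρ t) (renTerms≗subTerms ρ ts)

  mutual
    subTerm-∘ : ∀ {m n k} (σ : Sub L n k) (σ' : Sub L m n) →
                subTerm σ ∘ subTerm σ' ≗ subTerm (subTerm σ ∘ σ')
    subTerm-∘ σ σ' (var i)    = refl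
    subTerm-∘ σ σ' (fun f ts) = cong (fun f) (subTerms-∘ σ σ' ts)

    subTerms-∘ : ∀ {m n k j} (σ : Sub L n k) (σ' : Sub L m n) →
                 subTerms {k = j} σ ∘ subTerms σ' ≗ subTerms (subTerm σ ∘ σ')
    subTerms-∘ σ σ' []       = refl
    subTerms-∘ σ σ' (t ∷ ts) = cong₂ _∷_ (subTerm-∘ σ σ' t) (subTerms-∘ σ σ' ts)

  subTerm-var : ∀ {m} → subTerm {L} {m} var ≗ id
  subTerm-var t = trans (sym (renTerm≗subTerm id t)) (renTerm-id t)
    where
      mutual
        renTerm-id : ∀ {m} → renTerm {L} {m} id ≗ id
        renTerm-id (var i)    = refl
        renTerm-id (fun f ts) = cong (fun f) (renTerms-id ts)

        renTerms-id : ∀ {m k} → renTerms {L} {m} {k = k} id ≗ id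
        renTerms-id []       = refl
        renTerms-id (t ∷ ts) = cong₂ _∷_ (renTerm-id t) (renTerms-id ts)

  subTerm-renTerm : ∀ {m n k} (σ : Sub L n k) (ρ : Ren m n) →
                    subTerm σ ∘ renTerm ρ ≗ subTerm (σ ∘ ρ)
  subTerm-renTerm σ ρ t = trans (cong (subTerm σ) (renTerm≗subTerm ρ t)) (subTerm-∘ σ _ t)

  renTerm-subTerm : ∀ {m n k} (ρ : Ren n k) (σ : Sub L m n) →
                    renTerm ρ ∘ subTerm σ ≗ subTerm (renTerm ρ ∘ σ)
  renTerm-subTerm ρ σ t = begin
    renTerm ρ (subTerm σ t)                 ≡⟨ renTerm≗subTerm ρ _ ⟩
    subTerm (var ∘ ρ) (subTerm σ t)         ≡⟨ subTerm-∘ _ σ t ⟩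
    subTerm (subTerm (var ∘ ρ) ∘ σ) t       ≡⟨ subTerm-cong (sym ∘ renTerm≗subTerm ρ ∘ σ) t ⟩
    subTerm (renTerm ρ ∘ σ) t               ∎
    where open ≡-Reasoning

  liftSub-cong : ∀ {m n} {σ σ' : Sub L m n} → σ ≗ σ' → liftSub σ ≗ liftSub σ'
  liftSub-cong e zero    = refl
  liftSub-cong e (suc i) = cong (renTerm suc) (e i)

  sub-cong : ∀ {m n} {σ σ' : Sub L m n} → σ ≗ σ' → sub σ ≗ sub σ'
  sub-cong e (rel R ts) = cong (rel R) (subTerms-cong e ts)
  sub-cong e (s ≐ t)    = cong₂ _≐_ (subTerm-cong e s) (subTerm-cong e t)
  sub-cong e ⊥'         = refl
  sub-cong e (φ ⇒ ψ)    = cong₂ _⇒_ (sub-cong e φ) (sub-cong e ψ)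
  sub-cong e (∀' φ)     = cong ∀' (sub-cong (liftSub-cong e) φ)

  liftRen≗liftSub : ∀ {m n} (ρ : Ren m n) → var ∘ liftRen ρ ≗ liftSub {L} (var ∘ ρ)
  liftRen≗liftSub ρ zero    = refl
  liftRen≗liftSub ρ (suc i) = refl

  ren≗sub : ∀ {m n} (ρ : Ren m n) → ren {L} ρ ≗ sub (var ∘ ρ)
  ren≗sub ρ (rel R ts) = cong (rel R) (renTerms≗subTerms ρ ts)
  ren≗sub ρ (s ≐ t)    = cong₂ _≐_ (renTerm≗subTerm ρ s) (renTerm≗subTerm ρ t)
  ren≗sub ρ ⊥'         = refl
  ren≗sub ρ (φ ⇒ ψ)    = cong₂ _⇒_ (ren≗sub ρ φ) (ren≗sub ρ ψ)
  ren≗sub ρ (∀' φ)     =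
    cong ∀' (trans (ren≗sub (liftRen ρ) φ) (sub-cong (liftRen≗liftSub ρ) φ))

  liftSub-∘ : ∀ {m n k} (σ : Sub L n k) (σ' : Sub L m n) →
              subTerm (liftSub σ) ∘ liftSub σ' ≗ liftSub (subTerm σ ∘ σ')
  liftSub-∘ σ σ' zero    = refl
  liftSub-∘ σ σ' (suc i) =
    trans (subTerm-renTerm (liftSub σ) suc (σ' i)) (sym (renTerm-subTerm suc σ (σ' i)))

  sub-∘ : ∀ {m n k} (σ : Sub L n k) (σ' : Sub L m n) → sub σ ∘ sub σ' ≗ sub (subTerm σ ∘ σ')
  sub-∘ σ σ' (rel R ts) = cong (rel R) (subTerms-∘ σ σ' ts)
  sub-∘ σ σ' (s ≐ t)    = cong₂ _≐_ (subTerm-∘ σ σ' s) (subTerm-∘ σ σ' t)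
  sub-∘ σ σ' ⊥'         = refl
  sub-∘ σ σ' (φ ⇒ ψ)    = cong₂ _⇒_ (sub-∘ σ σ' φ) (sub-∘ σ σ' ψ)
  sub-∘ σ σ' (∀' φ)     =
    cong ∀' (trans (sub-∘ (liftSub σ) (liftSub σ') φ) (sub-cong (liftSub-∘ σ σ') φ))

  sub-var : ∀ {m} → sub {L} {m} var ≗ id
  sub-var (rel R ts) = cong (rel R) (subTerms-var ts)
    where
      subTerms-var : ∀ {m k} → subTerms {L} {m} {k = k} var ≗ id
      subTerms-var []       = refl
      subTerms-var (t ∷ ts) = cong₂ _∷_ (subTerm-var t) (subTerms-var ts)
  sub-var (s ≐ t)    = cong₂ _≐_ (subTerm-var s) (subTerm-var t)
  sub-var ⊥'         = refl
  sub-var (φ ⇒ ψ)    = cong₂ _⇒_ (sub-var φ) (sub-var ψ)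
  sub-var (∀' φ)     = cong ∀' (trans (sub-cong liftSub-var φ) (sub-var φ))
    where
      liftSub-var : ∀ {m} → liftSub {L} {m} var ≗ var
      liftSub-var zero    = refl
      liftSub-var (suc i) = refl

  ren-cong : ∀ {m n} {ρ ρ' : Ren m n} → ρ ≗ ρ' → ren {L} ρ ≗ ren ρ'
  ren-cong e φ = trans (ren≗sub _ φ) (trans (sub-cong (cong var ∘ e) φ) (sym (ren≗sub _ φ)))

  sub-ren : ∀ {m n k} (σ : Sub L n k) (ρ : Ren m n) → sub σ ∘ ren ρ ≗ sub (σ ∘ ρ)
  sub-ren σ ρ φ = trans (cong (sub σ) (ren≗sub ρ φ)) (sub-∘ σ _ φ)

  ren-sub : ∀ {m n k} (ρ : Ren n k) (σ : Sub L m n) → ren ρ ∘ sub σ ≗ sub (renTerm ρ ∘ σ)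
  ren-sub ρ σ φ = begin
    ren ρ (sub σ φ)                 ≡⟨ ren≗sub ρ _ ⟩
    sub (var ∘ ρ) (sub σ φ)         ≡⟨ sub-∘ _ σ φ ⟩
    sub (subTerm (var ∘ ρ) ∘ σ) φ   ≡⟨ sub-cong (sym ∘ renTerm≗subTerm ρ ∘ σ) φ ⟩
    sub (renTerm ρ ∘ σ) φ           ∎
    where open ≡-Reasoning

  ren-∘ : ∀ {m n k} (ρ : Ren n k) (ρ' : Ren m n) → ren {L} ρ ∘ ren ρ' ≗ ren (ρ ∘ ρ')
  ren-∘ ρ ρ' φ = begin
    ren ρ (ren ρ' φ)          ≡⟨ cong (ren ρ) (ren≗sub ρ' φ) ⟩
    ren ρ (sub (var ∘ ρ') φ)  ≡⟨ ren-sub ρ _ φ ⟩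
    sub (var ∘ ρ ∘ ρ') φ      ≡⟨ sym (ren≗sub _ φ) ⟩
    ren (ρ ∘ ρ') φ            ∎
    where open ≡-Reasoning

  ren-closed : ∀ {n} (ρ : Ren 0 n) (C : Sentence L) → ren ρ C ≡ open₀ C
  ren-closed ρ = ren-cong (λ ())

  open₀-id : (C : Sentence L) → open₀ C ≡ C
  open₀-id C = trans (ren≗sub _ C) (trans (sub-cong (λ ()) C) (sub-var C))

  ren-open₀ : ∀ {n k} (ρ : Ren n k) (C : Sentence L) → ren ρ (open₀ {L} {n} C) ≡ open₀ C
  ren-open₀ ρ C = trans (ren-∘ ρ _ C) (ren-closed _ C)

  sub-open₀ : ∀ {n k} (σ : Sub L n k) (C : Sentence L) → sub σ (open₀ {L} {n} C) ≡ open₀ C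
  sub-open₀ σ C = trans (sub-ren σ _ C) (trans (sub-cong (λ ()) C) (sym (ren≗sub _ C)))

module Derivations {L : Signature} (T : Theory L) where
  open Substitution {L}

  ren-[]₀ : ∀ {m n} (ρ : Ren m n) (φ : Formula L (suc m)) (t : Term L m) →
            ren ρ (φ [ t ]₀) ≡ ren (liftRen ρ) φ [ renTerm ρ t ]₀
  ren-[]₀ ρ φ t =
    trans (ren-sub ρ _ φ)
          (trans (sub-cong (λ { zero → refl ; (suc i) → refl }) φ) (sym (sub-ren _ (liftRen ρ) φ)))

  ⊢-ren : ∀ {m n} (ρ : Ren m n) {φ : Formula L m} → T ⊢ φ → T ⊢ ren ρ φ
  ⊢-ren ρ (axiom {φ = C} a) = subst (T ⊢_) (sym (ren-open₀ ρ C)) (axiom a)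
  ⊢-ren ρ ax-K              = ax-K
  ⊢-ren ρ ax-S              = ax-S
  ⊢-ren ρ ax-DN             = ax-DN
  ⊢-ren ρ (mp d e)          = mp (⊢-ren ρ d) (⊢-ren ρ e)
  ⊢-ren ρ (gen d)           = gen (⊢-ren (liftRen ρ) d)
  ⊢-ren ρ (ax-∀E {φ = φ} t) =
    subst (λ χ → T ⊢ ∀' (ren (liftRen ρ) φ) ⇒ χ) (sym (ren-[]₀ ρ φ t)) (ax-∀E (renTerm ρ t))
  ⊢-ren ρ (ax-∀D {φ = φ} {ψ = ψ}) =
    subst (λ χ → T ⊢ ∀' (χ ⇒ ren (liftRen ρ) ψ) ⇒ ren ρ φ ⇒ ∀' (ren (liftRen ρ) ψ))
          (trans (ren-∘ suc ρ φ) (sym (ren-∘ (liftRen ρ) suc φ))) ax-∀D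
  ⊢-ren ρ (ax-refl t)       = ax-refl (renTerm ρ t)
  ⊢-ren ρ (ax-leib {φ = φ} s t) =
    subst₂ (λ χ χ' → T ⊢ renTerm ρ s ≐ renTerm ρ t ⇒ χ ⇒ χ') (sym (ren-[]₀ ρ φ s)) (sym (ren-[]₀ ρ φ t))
      (ax-leib {φ = ren (liftRen ρ) φ} (renTerm ρ s) (renTerm ρ t))

  ⊢-open₀ : ∀ {n} {C : Sentence L} → T ⊢ C → T ⊢ open₀ {L} {n} C
  ⊢-open₀ {C = C} d = subst (T ⊢_) (ren-closed _ C) (⊢-ren (λ ()) d)

  infix 2 _⊩_
  data _⊩_ : ∀ {n} → List (Formula L n) → Formula L n → Set where
    hyp : ∀ {n} {Γ : List (Formula L n)} {φ} → φ ∈ Γ → Γ ⊩ φ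
    thm : ∀ {n} {Γ : List (Formula L n)} {φ} → T ⊢ φ → Γ ⊩ φ
    ⇒E  : ∀ {n} {Γ : List (Formula L n)} {φ ψ} → Γ ⊩ φ ⇒ ψ → Γ ⊩ φ → Γ ⊩ ψ
    ∀I  : ∀ {n} {Γ : List (Formula L n)} {φ} → map wk Γ ⊩ φ → Γ ⊩ ∀' φ

  ⊢-id : ∀ {n} {φ : Formula L n} → T ⊢ φ ⇒ φ
  ⊢-id {φ = φ} = mp (mp ax-S ax-K) (ax-K {ψ = φ})

  ⇒I : ∀ {n} {Γ : List (Formula L n)} {A φ} → A ∷ Γ ⊩ φ → Γ ⊩ A ⇒ φ
  ⇒I (hyp (here refl)) = thm ⊢-id
  ⇒I (hyp (there p))   = ⇒E (thm ax-K) (hyp p)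
  ⇒I (thm d)           = ⇒E (thm ax-K) (thm d)
  ⇒I (⇒E d e)          = ⇒E (⇒E (thm ax-S) (⇒I d)) (⇒I e)
  ⇒I (∀I d)            = ⇒E (thm ax-∀D) (∀I (⇒I d))

  closed : ∀ {n} {φ : Formula L n} → [] ⊩ φ → T ⊢ φ
  closed (hyp ())
  closed (thm d)   = d
  closed (⇒E d e)  = mp (closed d) (closed e)
  closed (∀I d)    = gen (closed d)

  weaken₀ : ∀ {n} {Γ : List (Formula L n)} {φ} → [] ⊩ φ → Γ ⊩ φ
  weaken₀ (hyp ())
  weaken₀ (thm d)  = thm d
  weaken₀ (⇒E d e) = ⇒E (weaken₀ d) (weaken₀ e)
  weaken₀ (∀I d)   = ∀I (weaken₀ d)

  cast : ∀ {n} {Γ : List (Formula L n)} {φ ψ} → φ ≡ ψ → Γ ⊩ φ → Γ ⊩ ψ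
  cast refl d = d

  cut : ∀ {n} {Γ : List (Formula L n)} {A φ} → Γ ⊩ A → A ∷ Γ ⊩ φ → Γ ⊩ φ
  cut a d = ⇒E (⇒I d) a

  h0 : ∀ {n} {Γ : List (Formula L n)} {A} → A ∷ Γ ⊩ A
  h0 = hyp (here refl)
  h1 : ∀ {n} {Γ : List (Formula L n)} {A B} → B ∷ A ∷ Γ ⊩ A
  h1 = hyp (there (here refl))
  h2 : ∀ {n} {Γ : List (Formula L n)} {A B C} → C ∷ B ∷ A ∷ Γ ⊩ A
  h2 = hyp (there (there (here refl)))
  h3 : ∀ {n} {Γ : List (Formula L n)} {A B C D} → D ∷ C ∷ B ∷ A ∷ Γ ⊩ A
  h3 = hyp (there (there (there (here refl))))
  h4 : ∀ {n} {Γ : List (Formula L n)} {A B C D E} → E ∷ D ∷ C ∷ B ∷ A ∷ Γ ⊩ A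
  h4 = hyp (there (there (there (there (here refl)))))
  h6 : ∀ {n} {Γ : List (Formula L n)} {A B C D E F G} → G ∷ F ∷ E ∷ D ∷ C ∷ B ∷ A ∷ Γ ⊩ A
  h6 = hyp (there (there (there (there (there (there (here refl)))))))
  h8 : ∀ {n} {Γ : List (Formula L n)} {A B C D E F G H I} → I ∷ H ∷ G ∷ F ∷ E ∷ D ∷ C ∷ B ∷ A ∷ Γ ⊩ A
  h8 = hyp (there (there (there (there (there (there (there (there (here refl)))))))))

  byContra : ∀ {n} {Γ : List (Formula L n)} {A} → ¬' A ∷ Γ ⊩ ⊥' → Γ ⊩ A
  byContra d = ⇒E (thm ax-DN) (⇒I d)

  ∧I : ∀ {n} {Γ : List (Formula L n)} {A B} → Γ ⊩ A → Γ ⊩ B → Γ ⊩ A ∧' B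
  ∧I a b = ⇒E (⇒E (weaken₀ (⇒I (⇒I (⇒I (⇒E (⇒E h0 h2) h1))))) a) b

  ∧E₁ : ∀ {n} {Γ : List (Formula L n)} {A B} → Γ ⊩ A ∧' B → Γ ⊩ A
  ∧E₁ d = ⇒E (weaken₀ (⇒I (byContra (⇒E h1 (⇒I (⇒I (⇒E h2 h1))))))) d

  ∧E₂ : ∀ {n} {Γ : List (Formula L n)} {A B} → Γ ⊩ A ∧' B → Γ ⊩ B
  ∧E₂ d = ⇒E (weaken₀ (⇒I (byContra (⇒E h1 (⇒I h1))))) d

  ∀E : ∀ {n} {Γ : List (Formula L n)} {φ : Formula L (suc n)} (t : Term L n) → Γ ⊩ ∀' φ → Γ ⊩ φ [ t ]₀
  ∀E t d = ⇒E (thm (ax-∀E t)) d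

  ∀E-fresh : ∀ {n} {Γ : List (Formula L (suc n))} {φ : Formula L (suc n)} → Γ ⊩ wk (∀' φ) → Γ ⊩ φ
  ∀E-fresh {φ = φ} d = cast instantiate (∀E (var zero) d)
    where
      instantiate : ren (liftRen suc) φ [ var zero ]₀ ≡ φ
      instantiate = trans (sub-ren _ (liftRen suc) φ)
                          (trans (sub-cong (λ { zero → refl ; (suc i) → refl }) φ) (sub-var φ))

module _ {L : Signature} where
  open Substitution {L}

  infix 2 _⊢ᵀ_
  _⊢ᵀ_ : Theory L → Theory L → Set
  B ⊢ᵀ A = ∀ ψ → A ψ → B ⊢ ψ

  ⊢ᵀ-transport : ∀ {A B : Theory L} → B ⊢ᵀ A → ∀ {n} {φ : Formula L n} → A ⊢ φ → B ⊢ φ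
  ⊢ᵀ-transport {B = B} I (axiom {φ = ψ} a) = Derivations.⊢-open₀ B (I ψ a)
  ⊢ᵀ-transport I ax-K          = ax-K
  ⊢ᵀ-transport I ax-S          = ax-S
  ⊢ᵀ-transport I ax-DN         = ax-DN
  ⊢ᵀ-transport I (mp d e)      = mp (⊢ᵀ-transport I d) (⊢ᵀ-transport I e)
  ⊢ᵀ-transport I (gen d)       = gen (⊢ᵀ-transport I d)
  ⊢ᵀ-transport I (ax-∀E t)     = ax-∀E t
  ⊢ᵀ-transport I ax-∀D         = ax-∀D
  ⊢ᵀ-transport I (ax-refl t)   = ax-refl t
  ⊢ᵀ-transport I (ax-leib s t) = ax-leib s t

  ⊢ᵀ-trans : ∀ {A B C : Theory L} → C ⊢ᵀ B → B ⊢ᵀ A → C ⊢ᵀ A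
  ⊢ᵀ-trans J I ψ a = ⊢ᵀ-transport J (I ψ a)

  axiom₀ : ∀ {B : Theory L} {ψ : Sentence L} → B ψ → B ⊢ ψ
  axiom₀ {B} {ψ} a = subst (B ⊢_) (open₀-id ψ) (axiom a)

  ⊆⇒⊢ᵀ : ∀ {A B : Theory L} → (∀ {ψ} → A ψ → B ψ) → B ⊢ᵀ A
  ⊆⇒⊢ᵀ A⊆B ψ a = axiom₀ (A⊆B a)

  ⊢ᵀ-∪ : ∀ {A A' B : Theory L} → B ⊢ᵀ A → B ⊢ᵀ A' → B ⊢ᵀ A ∪ᵀ A'
  ⊢ᵀ-∪ I I' ψ (inj₁ a) = I ψ a
  ⊢ᵀ-∪ I I' ψ (inj₂ a) = I' ψ a

  ∪-⊢ᵀ : ∀ {A A' B B' : Theory L} → B ⊢ᵀ A → B' ⊢ᵀ A' → B ∪ᵀ B' ⊢ᵀ A ∪ᵀ A'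
  ∪-⊢ᵀ I I' = ⊢ᵀ-∪ (⊢ᵀ-trans (⊆⇒⊢ᵀ inj₁) I) (⊢ᵀ-trans (⊆⇒⊢ᵀ inj₂) I')

  ⊢ᵀ⇒≡ᵈ : ∀ {A B : Theory L} → B ⊢ᵀ A → A ⊢ᵀ B → A ≡ᵈ B
  ⊢ᵀ⇒≡ᵈ I J = (λ φ → ⊢ᵀ-transport I) , (λ φ → ⊢ᵀ-transport J)

  ≡ᵈ⇒⊢ᵀ : ∀ {A B : Theory L} → A ≡ᵈ B → B ⊢ᵀ A
  ≡ᵈ⇒⊢ᵀ (A⇒B , _) ψ a = A⇒B ψ (axiom₀ a)

data PrdFree : ∀ {n} → Formula Lap n → Set where
  graph : ∀ {n f} {ts : Vec (Term Lap n) _} → PrdFree (rel (graph f) ts)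
  leq   : ∀ {n} {ts : Vec (Term Lap n) 2} → PrdFree (rel leq ts)
  _≐_   : ∀ {n} {s t : Term Lap n} → PrdFree (s ≐ t)
  ⊥'    : ∀ {n} → PrdFree {n} ⊥'
  _⇒_   : ∀ {n} {φ ψ : Formula Lap n} → PrdFree φ → PrdFree ψ → PrdFree (φ ⇒ ψ)
  ∀'    : ∀ {n} {φ : Formula Lap (suc n)} → PrdFree φ → PrdFree (∀' φ)

PrdFree-ren : ∀ {m n} (ρ : Ren m n) {φ : Formula Lap m} → PrdFree φ → PrdFree (ren ρ φ)
PrdFree-ren ρ graph   = graph
PrdFree-ren ρ leq     = leq
PrdFree-ren ρ _≐_     = _≐_
PrdFree-ren ρ ⊥'      = ⊥'
PrdFree-ren ρ (p ⇒ q) = PrdFree-ren ρ p ⇒ PrdFree-ren ρ q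
PrdFree-ren ρ (∀' p)  = ∀' (PrdFree-ren (liftRen ρ) p)

PrdFree-¬ : ∀ {n} {φ : Formula Lap n} → PrdFree φ → PrdFree (¬' φ)
PrdFree-¬ p = p ⇒ ⊥'

PrdFree-∧ : ∀ {n} {φ ψ : Formula Lap n} → PrdFree φ → PrdFree ψ → PrdFree (φ ∧' ψ)
PrdFree-∧ p q = PrdFree-¬ (p ⇒ PrdFree-¬ q)

PrdFree-∃ : ∀ {n} {φ : Formula Lap (suc n)} → PrdFree φ → PrdFree (∃' φ)
PrdFree-∃ p = PrdFree-¬ (∀' (PrdFree-¬ p))

PrdFree-Num : ∀ k → PrdFree (Num k)
PrdFree-Num zero    = graph
PrdFree-Num (suc k) = PrdFree-∃ (PrdFree-∧ (PrdFree-ren _ (PrdFree-Num k)) graph)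

PrdFree-isNum : ∀ {n} k (i : Fin n) → PrdFree (isNum k i)
PrdFree-isNum k i = PrdFree-ren _ (PrdFree-Num k)

PrdFree-numUpTo : ∀ k → PrdFree (numUpTo k)
PrdFree-numUpTo zero    = graph
PrdFree-numUpTo (suc k) = PrdFree-¬ (PrdFree-numUpTo k) ⇒ PrdFree-Num (suc k)

data AxiomShape : Sentence Lap → Set where
  prdNumeral : ∀ n → AxiomShape (pAx n)
  prdCong    : AxiomShape (relCongAx prd zero)
  prdFree    : ∀ {φ} → PrdFree φ → AxiomShape φ

axiomShape : ∀ {φ} → R0p+id φ → AxiomShape φ
axiomShape (plus m n)  = prdFree (PrdFree-∃ (PrdFree-∃ (PrdFree-∃ (PrdFree-∧ (PrdFree-isNum m _)
                           (PrdFree-∧ (PrdFree-isNum n _) (PrdFree-∧ (PrdFree-isNum (m + n) _) graph))))))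
axiomShape (times m n) = prdFree (PrdFree-∃ (PrdFree-∃ (PrdFree-∃ (PrdFree-∧ (PrdFree-isNum m _)
                           (PrdFree-∧ (PrdFree-isNum n _) (PrdFree-∧ (PrdFree-isNum (m * n) _) graph))))))
axiomShape (neq m n _) = prdFree (PrdFree-¬ (PrdFree-∃ (PrdFree-∃ (PrdFree-∧ (PrdFree-isNum m _)
                           (PrdFree-∧ (PrdFree-isNum n _) _≐_)))))
axiomShape (leBound n) = prdFree (∀' (PrdFree-∃ (PrdFree-∧ (PrdFree-isNum n _) leq) ⇒ PrdFree-numUpTo n))
axiomShape (le m n _)  = prdFree (PrdFree-∃ (PrdFree-∃ (PrdFree-∧ (PrdFree-isNum m _)
                           (PrdFree-∧ (PrdFree-isNum n _) leq))))
axiomShape (pred n)    = prdNumeral n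
axiomShape idRefl      = prdFree (∀' _≐_)
axiomShape (idRel (graph zeroF) j) = prdFree (∀' (∀' (PrdFree-∧ _≐_ graph ⇒ graph)))
axiomShape (idRel (graph succF) j) = prdFree (∀' (∀' (∀' (PrdFree-∧ _≐_ graph ⇒ graph))))
axiomShape (idRel (graph addF) j)  = prdFree (∀' (∀' (∀' (∀' (PrdFree-∧ _≐_ graph ⇒ graph)))))
axiomShape (idRel (graph mulF) j)  = prdFree (∀' (∀' (∀' (∀' (PrdFree-∧ _≐_ graph ⇒ graph)))))
axiomShape (idRel leq j)           = prdFree (∀' (∀' (∀' (PrdFree-∧ _≐_ leq ⇒ leq))))
axiomShape (idRel prd zero)        = prdCong
axiomShape (idEq j)                = prdFree (∀' (∀' (∀' (PrdFree-∧ _≐_ _≐_ ⇒ _≐_))))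
axiomShape (idTotal zeroF)         = prdFree (PrdFree-∃ graph)
axiomShape (idTotal succF)         = prdFree (∀' (PrdFree-∃ graph))
axiomShape (idTotal addF)          = prdFree (∀' (∀' (PrdFree-∃ graph)))
axiomShape (idTotal mulF)          = prdFree (∀' (∀' (PrdFree-∃ graph)))
axiomShape (idFunction zeroF)      = prdFree (∀' (∀' (PrdFree-∧ graph graph ⇒ _≐_)))
axiomShape (idFunction succF)      = prdFree (∀' (∀' (∀' (PrdFree-∧ graph graph ⇒ _≐_))))
axiomShape (idFunction addF)       = prdFree (∀' (∀' (∀' (∀' (PrdFree-∧ graph graph ⇒ _≐_)))))
axiomShape (idFunction mulF)       = prdFree (∀' (∀' (∀' (∀' (PrdFree-∧ graph graph ⇒ _≐_)))))

module _ {L : Signature} where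
  open Substitution {L}

  trTerm-irrelevant : ∀ (τ₁ τ₂ : Translation L) {n} → trTerm τ₁ {n} ≗ trTerm τ₂
  trTerm-irrelevant τ₁ τ₂ (var i) = refl

  trTerms-irrelevant : ∀ (τ₁ τ₂ : Translation L) {n k} → trTerms τ₁ {n} {k} ≗ trTerms τ₂
  trTerms-irrelevant τ₁ τ₂ []       = refl
  trTerms-irrelevant τ₁ τ₂ (t ∷ ts) = cong₂ _∷_ (trTerm-irrelevant τ₁ τ₂ t) (trTerms-irrelevant τ₁ τ₂ ts)

  translate-agree : ∀ (τ₁ τ₂ : Translation L) → AgreeOn𝕃a τ₁ τ₂ →
                      ∀ {n} {φ : Formula Lap n} → PrdFree φ → translate τ₁ φ ≡ translate τ₂ φ
  translate-agree τ₁ τ₂ (_ , _ , g , _) {φ = rel (graph f) ts} graph =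
    cong₂ (sub ∘ lookup) (trTerms-irrelevant τ₁ τ₂ ts) (g f)
  translate-agree τ₁ τ₂ (_ , _ , _ , l) {φ = rel leq ts} leq =
    cong₂ (sub ∘ lookup) (trTerms-irrelevant τ₁ τ₂ ts) l
  translate-agree τ₁ τ₂ (_ , e , _ , _) {φ = s ≐ t} _≐_ =
    cong₂ (sub ∘ lookup) (cong₂ (λ a b → a ∷ b ∷ []) (trTerm-irrelevant τ₁ τ₂ s) (trTerm-irrelevant τ₁ τ₂ t)) e
  translate-agree τ₁ τ₂ ag ⊥'      = refl
  translate-agree τ₁ τ₂ ag (p ⇒ q) = cong₂ _⇒_ (translate-agree τ₁ τ₂ ag p) (translate-agree τ₁ τ₂ ag q)
  translate-agree τ₁ τ₂ ag (∀' p)  =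
    cong ∀' (cong₂ _⇒_ (cong (ren (λ _ → zero)) (proj₁ ag)) (translate-agree τ₁ τ₂ ag p))

  trTerm-ren : ∀ (τ : Translation L) {m n} (ρ : Ren m n) (t : Term Lap m) →
               trTerm τ (renTerm ρ t) ≡ renTerm ρ (trTerm τ t)
  trTerm-ren τ ρ (var i) = refl

  lookup-trTerms-ren : ∀ (τ : Translation L) {m n k} (ρ : Ren m n) (ts : Vec (Term Lap m) k) (i : Fin k) →
                       lookup (trTerms τ (renTerms ρ ts)) i ≡ renTerm ρ (lookup (trTerms τ ts) i)
  lookup-trTerms-ren τ ρ (t ∷ ts) zero    = trTerm-ren τ ρ t
  lookup-trTerms-ren τ ρ (t ∷ ts) (suc i) = lookup-trTerms-ren τ ρ ts i

  translate-ren : ∀ (τ : Translation L) {m n} (ρ : Ren m n) (φ : Formula Lap m) →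
                  translate τ (ren ρ φ) ≡ ren ρ (translate τ φ)
  translate-ren τ ρ (rel R ts) =
    trans (sub-cong (lookup-trTerms-ren τ ρ ts) (relF τ R)) (sym (ren-sub ρ _ (relF τ R)))
  translate-ren τ ρ (s ≐ t)    =
    trans (sub-cong (λ { zero → trTerm-ren τ ρ s ; (suc zero) → trTerm-ren τ ρ t }) (eqF τ))
          (sym (ren-sub ρ _ (eqF τ)))
  translate-ren τ ρ ⊥'         = refl
  translate-ren τ ρ (φ ⇒ ψ)    = cong₂ _⇒_ (translate-ren τ ρ φ) (translate-ren τ ρ ψ)
  translate-ren τ ρ (∀' φ)     =
    cong ∀' (cong₂ _⇒_ (sym (ren-∘ (liftRen ρ) (λ _ → zero) (dom τ))) (translate-ren τ (liftRen ρ) φ))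

interleave : ∀ {A : Set} → (ℕ → A) → (ℕ → A) → ℕ → A
interleave a b zero    = a zero
interleave a b (suc n) = interleave b (a ∘ suc) n

mutual
  interleave-left : ∀ {A : Set} (a b : ℕ → A) k → ∃ λ n → interleave a b n ≡ a k
  interleave-left a b zero    = zero , refl
  interleave-left a b (suc k) with interleave-right b (a ∘ suc) k
  ... | n , e = suc n , e

  interleave-right : ∀ {A : Set} (a b : ℕ → A) k → ∃ λ n → interleave a b n ≡ b k
  interleave-right a b k with interleave-left b (a ∘ suc) k
  ... | n , e = suc n , e

interleave-cases : ∀ {A : Set} (a b : ℕ → A) n →
                   (∃ λ k → interleave a b n ≡ a k) ⊎ (∃ λ k → interleave a b n ≡ b k)
interleave-cases a b zero    = inj₁ (zero , refl)
interleave-cases a b (suc n) with interleave-cases b (a ∘ suc) n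
... | inj₁ (k , e) = inj₂ (k , e)
... | inj₂ (k , e) = inj₁ (suc k , e)

IsCE-∪ : ∀ {L} (U V : Theory L) → IsCE U → IsCE V → IsCE (U ∪ᵀ V)
IsCE-∪ U V (eU , enumU) (eV , enumV) = interleave eU eV , λ φ → enumerated φ , listed φ
  where
    enumerated : ∀ φ → (U ∪ᵀ V) φ → ∃ λ n → interleave eU eV n ≡ just φ
    enumerated φ (inj₁ u) with proj₁ (enumU φ) u
    ... | k , e with interleave-left eU eV k
    ... | n , e' = n , trans e' e
    enumerated φ (inj₂ v) with proj₁ (enumV φ) v
    ... | k , e with interleave-right eU eV k
    ... | n , e' = n , trans e' e

    listed : ∀ φ → (∃ λ n → interleave eU eV n ≡ just φ) → (U ∪ᵀ V) φ
    listed φ (n , e) with interleave-cases eU eV n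
    ... | inj₁ (k , e') = inj₁ (proj₂ (enumU φ) (k , trans (sym e') e))
    ... | inj₂ (k , e') = inj₂ (proj₂ (enumV φ) (k , trans (sym e') e))

module Relativized {L : Signature} (τ : Translation L) where
  open Substitution {L}

  D⟨_⟩ : ∀ {n} → Fin n → Formula L n
  D⟨ x ⟩ = ren (λ _ → x) (dom τ)

  infix 9 _＠_
  _＠_ : ∀ {k n} → Formula L k → Vec (Fin n) k → Formula L n
  F ＠ xs = sub (lookup (Vec.map var xs)) F

  E : Formula L 2
  E = eqF τ

  S : Formula L 2
  S = relF τ (graph succF)

  Unique : Formula L 1 → Sentence L
  Unique Q = ∀' (D⟨ zero ⟩ ⇒ Q ⇒ ∀' (D⟨ zero ⟩ ⇒ ren (liftRen suc) Q ⇒ E ＠ (suc zero ∷ zero ∷ [])))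

  ∃ᴰ : ∀ {n} → Formula L (suc n) → Formula L n
  ∃ᴰ φ = ¬' (∀' (D⟨ zero ⟩ ⇒ ¬' φ))

  Successor : Formula L 1 → Formula L 1
  Successor Q = ∃ᴰ (ren (λ _ → zero) Q ∧' S ＠ (zero ∷ suc zero ∷ []))

  Numᵀ : ℕ → Formula L 1
  Numᵀ k = translate τ (Num k)

  Numᵀ-suc : ∀ k → Numᵀ (suc k) ≡ Successor (Numᵀ k)
  Numᵀ-suc k = cong (λ Q → ∃ᴰ (Q ∧' S ＠ (zero ∷ suc zero ∷ [])))
                    (translate-ren τ (λ _ → zero) (Num k))

  isNumᵀ : ℕ → Formula L 1
  isNumᵀ n = translate τ (isNum n zero)

  isNumᵀ≡Numᵀ : ∀ n → isNumᵀ n ≡ Numᵀ n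
  isNumᵀ≡Numᵀ n = trans (translate-ren τ (λ _ → zero) (Num n))
                        (trans (ren≗sub _ (Numᵀ n)) (trans (sub-cong (λ { zero → refl }) (Numᵀ n)) (sub-var (Numᵀ n))))

  -- Atoms reached through different chains of renamings and instantiations are
  -- compared by writing both as  sub θ F  for one base formula F (proofs of the
  -- shape  X ≡ sub θ F  below) and checking the two substitutions pointwise.
  same-instance : ∀ {m n} {X Y : Formula L n} {θ θ' : Sub L m n} {F : Formula L m} →
                  X ≡ sub θ F → Y ≡ sub θ' F → θ ≗ θ' → X ≡ Y
  same-instance {F = F} p q e = trans p (trans (sub-cong e F) (sym q))

  instance-ren : ∀ {m n k} {ρ : Ren n k} {X : Formula L n} {θ : Sub L m n} {F : Formula L m} →
                 X ≡ sub θ F → ren ρ X ≡ sub (renTerm ρ ∘ θ) F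
  instance-ren {ρ = ρ} {θ = θ} {F} p = trans (cong (ren ρ) p) (ren-sub ρ θ F)

  instance-sub : ∀ {m n k} {σ : Sub L n k} {X : Formula L n} {θ : Sub L m n} {F : Formula L m} →
                 X ≡ sub θ F → sub σ X ≡ sub (subTerm σ ∘ θ) F
  instance-sub {σ = σ} {θ = θ} {F} p = trans (cong (sub σ) p) (sub-∘ σ θ F)

  instance-base : ∀ {m n} {ρ : Ren m n} {F : Formula L m} → ren ρ F ≡ sub (var ∘ ρ) F
  instance-base {ρ = ρ} {F} = ren≗sub ρ F

  ε : ∀ {n} → Sub L 0 n
  ε ()

  infixl 5 _▸_
  _▸_ : ∀ {m n} → Sub L m n → Term L n → Sub L (suc m) n
  (θ ▸ t) zero    = t
  (θ ▸ t) (suc i) = θ i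

  sub-liftSub-[]₀ : ∀ {m n} (θ : Sub L m n) (t : Term L n) (X : Formula L (suc m)) →
                    sub (liftSub θ) X [ t ]₀ ≡ sub (θ ▸ t) X
  sub-liftSub-[]₀ θ t X = trans (sub-∘ _ _ X) (sub-cong pointwise X)
    where
      pointwise : subTerm _ ∘ liftSub θ ≗ θ ▸ t
      pointwise zero    = refl
      pointwise (suc i) = trans (subTerm-renTerm _ suc (θ i)) (subTerm-var (θ i))

  sub-sub-≗ : ∀ {k n m} {F : Formula L k} {σ : Sub L k m} {θ : Sub L m n} {σ' : Sub L k n} →
              subTerm θ ∘ σ ≗ σ' → sub θ (sub σ F) ≡ sub σ' F
  sub-sub-≗ {F = F} {σ} {θ} e = trans (sub-∘ θ σ F) (sub-cong e F)

  module Reasoning (T : Theory L) where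
    open Derivations T

    ∀⇒E : ∀ {n m} {Γ : List (Formula L n)} {θ : Sub L m n} {A B : Formula L (suc m)} (t : Term L n) →
          Γ ⊩ sub θ (∀' (A ⇒ B)) → Γ ⊩ sub (θ ▸ t) A → Γ ⊩ sub (θ ▸ t) B
    ∀⇒E {θ = θ} {A} {B} t d a =
      ⇒E (cast (cong₂ _⇒_ (sub-liftSub-[]₀ θ t A) (sub-liftSub-[]₀ θ t B)) (∀E t d)) a

    thm-closed : ∀ {n} {Γ : List (Formula L n)} {C : Sentence L} → T ⊢ C → Γ ⊩ sub ε C
    thm-closed {C = C} d = cast (trans (ren≗sub _ C) (sub-cong (λ ()) C)) (thm (⊢-open₀ d))

    thm-wk : ∀ {Γ : List (Formula L 1)} {C : Sentence L} → T ⊢ C → Γ ⊩ wk C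
    thm-wk {C = C} d = cast (sym (ren-closed suc C)) (thm (⊢-open₀ d))

    D-instance : ∀ {m n} {θ : Sub L m n} (x : Fin n) {Γ : List (Formula L n)} →
                 Γ ⊩ D⟨ x ⟩ → Γ ⊩ sub (θ ▸ var x) D⟨ zero ⟩
    D-instance x d = cast (same-instance instance-base (instance-sub instance-base) (λ { zero → refl })) d

    ∀³E : ∀ {n} {Γ : List (Formula L n)} {B : Formula L 3} →
          T ⊢ ∀' (D⟨ zero ⟩ ⇒ ∀' (D⟨ zero ⟩ ⇒ ∀' (D⟨ zero ⟩ ⇒ B))) →
          (x y z : Fin n) → Γ ⊩ D⟨ x ⟩ → Γ ⊩ D⟨ y ⟩ → Γ ⊩ D⟨ z ⟩ →
          Γ ⊩ sub (ε ▸ var x ▸ var y ▸ var z) B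
    ∀³E ax x y z dx dy dz =
      ∀⇒E (var z) (∀⇒E (var y) (∀⇒E (var x) (thm-closed ax) (D-instance x dx)) (D-instance y dy)) (D-instance z dz)

    ∃E⊥ : ∀ {n} {Γ : List (Formula L n)} {A B : Formula L (suc n)} →
          Γ ⊩ ¬' ∀' (A ⇒ ¬' B) → B ∷ A ∷ map wk Γ ⊩ ⊥' → Γ ⊩ ⊥'
    ∃E⊥ ex d = ⇒E ex (∀I (⇒I (⇒I d)))

    unique-at : ∀ {n} {Γ : List (Formula L n)} {Q : Formula L 1} → T ⊢ Unique Q → (x y : Fin n) →
                Γ ⊩ D⟨ x ⟩ → Γ ⊩ Q ＠ (x ∷ []) → Γ ⊩ D⟨ y ⟩ → Γ ⊩ Q ＠ (y ∷ []) → Γ ⊩ E ＠ (x ∷ y ∷ [])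
    unique-at {Q = Q} u x y dx qx dy qy =
      cast (sub-sub-≗ (λ { zero → refl ; (suc zero) → refl }))
        (⇒E (∀⇒E (var y) (⇒E (∀⇒E (var x) (thm-closed u) (D-instance x dx))
                               (cast (sub-cong (λ { zero → refl }) Q) qx))
                 (D-instance y dy))
            (cast (same-instance refl (instance-sub instance-base) (λ { zero → refl })) qy))

  module Numerals where
    open Derivations (translatedR0p τ)
    open Reasoning (translatedR0p τ)

    axiomᵀ : ∀ {φ} → R0p+id φ → translatedR0p τ ⊢ translate τ φ
    axiomᵀ {φ} r = axiom₀ (φ , r , refl)

    successor-step : ∀ {n} {Γ : List (Formula L n)} {Q : Formula L 1} → translatedR0p τ ⊢ Unique Q →
                     (z z' a b : Fin n) → Γ ⊩ D⟨ z ⟩ → Γ ⊩ D⟨ z' ⟩ → Γ ⊩ D⟨ a ⟩ → Γ ⊩ D⟨ b ⟩ →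
                     Γ ⊩ Q ＠ (a ∷ []) → Γ ⊩ Q ＠ (b ∷ []) →
                     Γ ⊩ S ＠ (a ∷ z ∷ []) → Γ ⊩ S ＠ (b ∷ z' ∷ []) → Γ ⊩ E ＠ (z ∷ z' ∷ [])
    successor-step {Γ = Γ} u z z' a b dz dz' da db Qa Qb Saz Sbz' =
      cast (sub-sub-≗ λ { zero → refl ; (suc zero) → refl })
        (⇒E (∀³E (axiomᵀ (idFunction succF)) b z z' db dz dz')
            (∧I (cast (sym (sub-sub-≗ λ { zero → refl ; (suc zero) → refl })) Sbz)
                (cast (sym (sub-sub-≗ λ { zero → refl ; (suc zero) → refl })) Sbz')))
      where
        Sbz : Γ ⊩ S ＠ (b ∷ z ∷ [])
        Sbz = cast (sub-sub-≗ λ { zero → refl ; (suc zero) → refl })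
                (⇒E (∀³E (axiomᵀ (idRel (graph succF) zero)) z a b dz da db)
                    (∧I (cast (sym (sub-sub-≗ λ { zero → refl ; (suc zero) → refl })) (unique-at u a b da Qa db Qb))
                        (cast (sym (sub-sub-≗ λ { zero → refl ; (suc zero) → refl })) Saz)))

    zero-unique : translatedR0p τ ⊢ Unique (Numᵀ 0)
    zero-unique = closed (∀I (⇒I (⇒I (∀I (⇒I (⇒I
      (cast (sub-sub-≗ λ { zero → refl ; (suc zero) → refl })
        (⇒E (∀⇒E (var zero) (∀⇒E (var (suc zero)) (thm-closed (axiomᵀ (idFunction zeroF)))
                                   (D-instance (suc zero) (cast (ren-∘ suc _ (dom τ)) h3)))
                            (D-instance zero h1))
            (∧I (cast (same-instance (instance-ren refl) (instance-sub refl) (λ { zero → refl })) h2)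
                (cast (same-instance (instance-ren refl) (instance-sub refl) (λ { zero → refl })) h0))))))))))

    successor-unique : ∀ Q → translatedR0p τ ⊢ Unique Q → translatedR0p τ ⊢ Unique (Successor Q)
    successor-unique Q u = closed (∀I (⇒I (⇒I (∀I (⇒I (⇒I (byContra (∃E⊥ h3 (∃E⊥ h3
      (⇒E h4 (cast (same-instance refl (instance-ren (instance-ren refl)) λ { zero → refl ; (suc zero) → refl })
        (successor-step u (# 3) (# 2) (# 1) (# 0)
          (cast (same-instance (instance-ren (instance-ren (instance-ren instance-base))) instance-base λ { zero → refl }) h8)
          (cast (same-instance (instance-ren (instance-ren instance-base)) instance-base λ { zero → refl }) h6)
          (cast (same-instance (instance-ren (instance-ren instance-base)) instance-base λ { zero → refl }) h3)
          (cast (same-instance (instance-ren (instance-ren instance-base)) instance-base λ { zero → refl }) h1)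
          (cast (same-instance (instance-ren (instance-ren instance-base)) refl λ { zero → refl }) (∧E₁ h2))
          (cast (same-instance (instance-ren (instance-ren instance-base)) refl λ { zero → refl }) (∧E₁ h0))
          (cast (same-instance (instance-ren (instance-ren refl)) refl λ { zero → refl ; (suc zero) → refl }) (∧E₂ h2))
          (cast (same-instance (instance-ren (instance-ren refl)) refl λ { zero → refl ; (suc zero) → refl }) (∧E₂ h0))))))))))))))

    numeral-unique : ∀ k → translatedR0p τ ⊢ Unique (Numᵀ k)
    numeral-unique zero    = zero-unique
    numeral-unique (suc k) =
      subst (λ Q → translatedR0p τ ⊢ Unique Q) (sym (Numᵀ-suc k)) (successor-unique (Numᵀ k) (numeral-unique k))

-- τ' is given as τ with its relation formulas replaced, so that τ, τ' and τ''
-- share domain and identity formula definitionally.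
module Merge {L : Signature} (τ : Translation L) (relF' : (R : RelAp) → Formula L (relArityAp R))
             (graph-agree : ∀ f → relF τ (graph f) ≡ relF' (graph f)) (leq-agree : relF τ leq ≡ relF' leq) where
  open Substitution {L}
  open Relativized τ

  τ' : Translation L
  τ' = record { dom = dom τ ; eqF = eqF τ ; relF = relF' }

  P P' : Formula L 1
  P  = relF τ prd
  P' = relF τ' prd

  Congruent : Formula L 1 → Sentence L
  Congruent Q = ∀' (D⟨ zero ⟩ ⇒ ∀' (D⟨ zero ⟩ ⇒ ((E ＠ (suc zero ∷ zero ∷ []) ∧' Q ＠ (suc zero ∷ [])) ⇒ Q ＠ (zero ∷ []))))

  C : Sentence L
  C = Congruent P ∧' Congruent P'

  P'' : Formula L 1
  P'' = (open₀ C ∧' P) ∧' P'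

  τ'' : Translation L
  τ'' = record { dom = dom τ ; eqF = eqF τ ; relF = λ { (graph f) → relF τ (graph f) ; leq → relF τ leq ; prd → P'' } }

  T T' T'' : Theory L
  T   = translatedR0p τ
  T'  = translatedR0p τ'
  T'' = translatedR0p τ''

  τ''≈τ : AgreeOn𝕃a τ'' τ
  τ''≈τ = refl , refl , (λ f → refl) , refl

  τ≈τ'' : AgreeOn𝕃a τ τ''
  τ≈τ'' = refl , refl , (λ f → refl) , refl

  τ'≈τ : AgreeOn𝕃a τ' τ
  τ'≈τ = refl , refl , (λ f → sym (graph-agree f)) , sym leq-agree

  τ''≈τ' : AgreeOn𝕃a τ'' τ'
  τ''≈τ' = refl , refl , graph-agree , leq-agree

  isNumᵀ'' : ∀ n → translate τ'' (isNum n zero) ≡ isNumᵀ n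
  isNumᵀ'' n = translate-agree τ'' τ τ''≈τ (PrdFree-isNum n zero)

  isNumᵀ' : ∀ n → translate τ' (isNum n zero) ≡ isNumᵀ n
  isNumᵀ' n = translate-agree τ' τ τ'≈τ (PrdFree-isNum n zero)

  module InMerged where
    open Derivations T''
    open Reasoning T''

    axiom'' : ∀ {φ} → R0p+id φ → T'' ⊢ translate τ'' φ
    axiom'' {φ} r = axiom₀ (φ , r , refl)

    ∃ᴰ-mono : ∀ {A B} → T'' ⊢ ∃ᴰ A → (∀ {Γ : List (Formula L 1)} → Γ ⊩ A → Γ ⊩ B) → T'' ⊢ ∃ᴰ B
    ∃ᴰ-mono d f = closed (⇒I (∃E⊥ (thm d) (⇒E (⇒E (∀E-fresh h2) h1) (f h0))))

    merged⊢C : T'' ⊢ C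
    merged⊢C = closed (byContra (∃E⊥ (thm (axiom'' (pred 0)))
                 (⇒E h2 (cast (trans (sub-open₀ _ C) (sym (ren-closed suc C))) (∧E₁ (∧E₁ (∧E₂ h0)))))))

    merged⊢T : T'' ⊢ᵀ T
    merged⊢T ψ (φ , r , refl) = by-shape r (axiomShape r)
      where
        by-shape : ∀ {φ} → R0p+id φ → AxiomShape φ → T'' ⊢ translate τ φ
        by-shape r (prdNumeral n) =
          ∃ᴰ-mono (axiom'' (pred n)) λ h → ∧I (cast (isNumᵀ'' n) (∧E₁ h)) (∧E₂ (∧E₁ (∧E₂ h)))
        by-shape r prdCong        = closed (∧E₁ (thm merged⊢C))
        by-shape r (prdFree p)    = subst (T'' ⊢_) (translate-agree τ'' τ τ''≈τ p) (axiom'' r)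

    merged⊢T' : T'' ⊢ᵀ T'
    merged⊢T' ψ (φ , r , refl) = by-shape r (axiomShape r)
      where
        by-shape : ∀ {φ} → R0p+id φ → AxiomShape φ → T'' ⊢ translate τ' φ
        by-shape r (prdNumeral n) =
          ∃ᴰ-mono (axiom'' (pred n)) λ h → ∧I (cast (trans (isNumᵀ'' n) (sym (isNumᵀ' n))) (∧E₁ h)) (∧E₂ (∧E₂ h))
        by-shape r prdCong        = closed (∧E₂ (thm merged⊢C))
        by-shape r (prdFree p)    = subst (T'' ⊢_) (translate-agree τ'' τ' τ''≈τ' p) (axiom'' r)

  module InUnion where
    open Derivations (T ∪ᵀ T')
    open Reasoning (T ∪ᵀ T')

    axiomᵀ : ∀ {φ} → R0p+id φ → T ∪ᵀ T' ⊢ translate τ φ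
    axiomᵀ {φ} r = axiom₀ (inj₁ (φ , r , refl))

    axiomᵀ' : ∀ {φ} → R0p+id φ → T ∪ᵀ T' ⊢ translate τ' φ
    axiomᵀ' {φ} r = axiom₀ (inj₂ (φ , r , refl))

    isNumᵀ-unique : ∀ n → T ∪ᵀ T' ⊢ Unique (isNumᵀ n)
    isNumᵀ-unique n = subst (λ Q → T ∪ᵀ T' ⊢ Unique Q) (sym (isNumᵀ≡Numᵀ n))
                        (⊢ᵀ-transport (⊆⇒⊢ᵀ inj₁) (Numerals.numeral-unique n))

    union⊢C : T ∪ᵀ T' ⊢ C
    union⊢C = closed (∧I (thm (axiomᵀ (idRel prd zero))) (thm (axiomᵀ' (idRel prd zero))))

    union⊢Congruent-P'' : T ∪ᵀ T' ⊢ Congruent P''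
    union⊢Congruent-P'' = closed (∀I (⇒I (cut (⇒E (∀E-fresh (thm-wk congP)) h0) (cut (⇒E (∀E-fresh (thm-wk congP')) h1)
      (∀I (⇒I (⇒I (∧I (∧I (cast (sym (sub-open₀ _ C)) (thm (⊢-open₀ union⊢C)))
                          (⇒E (⇒E (∀E-fresh h3) h1) (∧I (∧E₁ h0) (∧E₂ (∧E₁ (∧E₂ h0))))))
                      (⇒E (⇒E (∀E-fresh h2) h1) (∧I (∧E₁ h0) (∧E₂ (∧E₂ h0))))))))))))
      where
        congP : T ∪ᵀ T' ⊢ Congruent P
        congP = axiomᵀ (idRel prd zero)
        congP' : T ∪ᵀ T' ⊢ Congruent P'
        congP' = axiomᵀ' (idRel prd zero)

    union⊢P''-numeral : ∀ n → T ∪ᵀ T' ⊢ ∃ᴰ (isNumᵀ n ∧' P'' ＠ (zero ∷ []))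
    union⊢P''-numeral n = closed (⇒I (∃E⊥ (thm P'-witness) (∃E⊥ (thm-wk P-witness)
      (⇒E (⇒E (∀E-fresh h4) h1)
          (∧I (∧E₁ h0) (∧I (∧I C-at-x (∧E₂ h0))
                           (cast (same-instance refl (instance-ren refl) λ { zero → refl }) P'x)))))))
      where
        P-witness : T ∪ᵀ T' ⊢ ∃ᴰ (isNumᵀ n ∧' P ＠ (zero ∷ []))
        P-witness = axiomᵀ (pred n)

        P'-witness : T ∪ᵀ T' ⊢ ∃ᴰ (isNumᵀ n ∧' P' ＠ (zero ∷ []))
        P'-witness = subst (λ N → T ∪ᵀ T' ⊢ ∃ᴰ (N ∧' P' ＠ (zero ∷ []))) (isNumᵀ' n) (axiomᵀ' (pred n))

        Γ : List (Formula L 2)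
        Γ = ren (liftRen suc) (isNumᵀ n ∧' P ＠ (zero ∷ [])) ∷ ren (liftRen suc) D⟨ zero ⟩ ∷
            wk (isNumᵀ n ∧' P' ＠ (zero ∷ [])) ∷ wk D⟨ zero ⟩ ∷
            wk (wk (∀' (D⟨ zero ⟩ ⇒ ¬' (isNumᵀ n ∧' P'' ＠ (zero ∷ []))))) ∷ []

        C-at-x : Γ ⊩ ren (liftRen suc) (open₀ C ＠ (zero ∷ []))
        C-at-x = cast (sym (trans (cong (ren (liftRen suc)) (sub-open₀ _ C)) (ren-open₀ (liftRen suc) C)))
                      (thm (⊢-open₀ union⊢C))

        Dx : Γ ⊩ D⟨ # 0 ⟩
        Dx = cast (same-instance (instance-ren instance-base) instance-base λ { zero → refl }) h1

        Dy : Γ ⊩ D⟨ # 1 ⟩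
        Dy = cast (same-instance (instance-ren instance-base) instance-base λ { zero → refl }) h3

        y≈x : Γ ⊩ E ＠ (# 1 ∷ # 0 ∷ [])
        y≈x = unique-at (isNumᵀ-unique n) (# 1) (# 0)
                Dy (cast (same-instance instance-base refl λ { zero → refl }) (∧E₁ h2))
                Dx (cast (same-instance instance-base refl λ { zero → refl }) (∧E₁ h0))

        P'x : Γ ⊩ P' ＠ (# 0 ∷ [])
        P'x = cast (same-instance (instance-sub refl) refl λ { zero → refl })
                (⇒E (∀⇒E (var (# 0)) (∀⇒E (var (# 1)) (thm-closed (axiomᵀ' (idRel prd zero))) (D-instance (# 1) Dy))
                                       (D-instance (# 0) Dx))
                    (∧I (cast (sym (sub-sub-≗ λ { zero → refl ; (suc zero) → refl })) y≈x)
                        (cast (same-instance (instance-ren refl) (instance-sub refl) λ { zero → refl }) (∧E₂ h2))))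

    union⊢merged : T ∪ᵀ T' ⊢ᵀ T''
    union⊢merged ψ (φ , r , refl) = by-shape r (axiomShape r)
      where
        by-shape : ∀ {φ} → R0p+id φ → AxiomShape φ → T ∪ᵀ T' ⊢ translate τ'' φ
        by-shape r (prdNumeral n) =
          subst (λ N → T ∪ᵀ T' ⊢ ∃ᴰ (N ∧' P'' ＠ (zero ∷ []))) (sym (isNumᵀ'' n)) (union⊢P''-numeral n)
        by-shape r prdCong        = union⊢Congruent-P''
        by-shape r (prdFree p)    = subst (T ∪ᵀ T' ⊢_) (translate-agree τ τ'' τ≈τ'' p) (axiomᵀ r)

  merged-sources-∪ : (U V : Theory L) → SourcedBy τ U → SourcedBy τ' V → SourcedBy τ'' (U ∪ᵀ V)
  merged-sources-∪ U V (ceU , U≡T) (ceV , V≡T') =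
    IsCE-∪ U V ceU ceV ,
    ⊢ᵀ⇒≡ᵈ (⊢ᵀ-trans (⊢ᵀ-∪ InMerged.merged⊢T InMerged.merged⊢T') (∪-⊢ᵀ (≡ᵈ⇒⊢ᵀ U≡T) (≡ᵈ⇒⊢ᵀ V≡T')))
          (⊢ᵀ-trans (∪-⊢ᵀ (≡ᵈ⇒⊢ᵀ (swap U≡T)) (≡ᵈ⇒⊢ᵀ (swap V≡T'))) InUnion.union⊢merged)

theorem5p12 : (L : Signature) (U V : Theory L) (τ τ' : Translation L) →
    SourcedBy τ U → SourcedBy τ' V → AgreeOn𝕃a τ τ' → Sourced (U ∪ᵀ V)
theorem5p12 L U V τ record { relF = relF' } sU sV (refl , refl , graph-agree , leq-agree) =
  τ'' , merged-sources-∪ U V sU sV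
  where open Merge τ relF' graph-agree leq-agree
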